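{- In the setting described in the context, for every $0\le i\le D$ the all-ones vector $\mathbb 1\in\mathbb R^{D+1}$ is an eigenvector of $B_i$ with eigenvalue $k_i$.
   Context: Let $D$ be a positive integer. Define $c_i=\frac{3(D-i+1)i(D+i+1)}{D(D+2)(2i+1)}$ ($1\le i\le D$), $a_i=\frac{3i(i+1)}{D(D+2)}$ ($0\le i\le D$), $b_i=\frac{3(D-i)(i+1)(D+i+2)}{D(D+2)(2i+1)}$ ($0\le i\le D-1$). Matrices are $(D+1)\times(D+1)$ real, indices $0,\dots,D$. $A$ is the tridiagonal matrix with $A_{i,i}=a_i$, $A_{i,i+1}=b_i$, $A_{i,i-1}=c_i$, all other entries $0$. Polynomials $u_0,\dots,u_D\in\mathbb R[\lambda]$: $u_0=1$, $u_1=\lambda/3$, $\lambda u_i=b_iu_{i+1}+a_iu_i+c_iu_{i-1}$ ($1\le i\le D-1$); $k_i=\frac{b_0\cdots b_{i-1}}{c_1\cdots c_i}$; $v_i=k_iu_i$; $B_i=v_i(A)$. -}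

module Defs where

open import Data.Nat as ℕ using (ℕ; zero; suc)
open import Data.Integer using (+_)
open import Data.Rational using (ℚ; 0ℚ; 1ℚ; _+_; _*_; _-_; 1/_; ≢-nonZero) renaming (_/_ to _//_)
open import Data.Rational.Properties using (_≟_)
open import Data.Fin using (Fin)
open import Data.List using (List; []; _∷_)
open import Relation.Nullary using (yes; no)

ℕ→ℚ : ℕ → ℚ
ℕ→ℚ n = (+ n) // 1

-- total division on ℚ (x ÷ 0 := 0); only ever used with nonzero divisors
_÷_ : ℚ → ℚ → ℚ
x ÷ y with y ≟ 0ℚ
... | yes _ = 0ℚ
... | no y≢0 = x * (1/_ y {{≢-nonZero y≢0}})

infixl 7 _÷_

module Coeffs (D : ℕ) where
  Dq : ℚ
  Dq = ℕ→ℚ D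

  den : ℚ
  den = Dq * (Dq + ℕ→ℚ 2)

  c : ℕ → ℚ
  c i = (ℕ→ℚ 3 * (Dq - ℕ→ℚ i + 1ℚ) * ℕ→ℚ i * (Dq + ℕ→ℚ i + 1ℚ))
        ÷ (den * (ℕ→ℚ 2 * ℕ→ℚ i + 1ℚ))

  a : ℕ → ℚ
  a i = (ℕ→ℚ 3 * ℕ→ℚ i * (ℕ→ℚ i + 1ℚ)) ÷ den

  b : ℕ → ℚ
  b i = (ℕ→ℚ 3 * (Dq - ℕ→ℚ i) * (ℕ→ℚ i + 1ℚ) * (Dq + ℕ→ℚ i + ℕ→ℚ 2))
        ÷ (den * (ℕ→ℚ 2 * ℕ→ℚ i + 1ℚ))

-- Polynomials over ℚ in λ: coefficient lists, lowest degree first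
Poly : Set
Poly = List ℚ

_+ₚ_ : Poly → Poly → Poly
[] +ₚ q = q
(x ∷ p) +ₚ [] = x ∷ p
(x ∷ p) +ₚ (y ∷ q) = (x + y) ∷ (p +ₚ q)

_·ₚ_ : ℚ → Poly → Poly
r ·ₚ [] = []
r ·ₚ (x ∷ p) = (r * x) ∷ (r ·ₚ p)

Xₚ·_ : Poly → Poly
Xₚ· p = 0ℚ ∷ p

Mat : ℕ → Set
Mat n = Fin n → Fin n → ℚ

Vect : ℕ → Set
Vect n = Fin n → ℚ

sumFin : (n : ℕ) → (Fin n → ℚ) → ℚ
sumFin zero f = 0ℚ
sumFin (suc n) f = f Fin.zero + sumFin n (λ j → f (Fin.suc j))

idM : (n : ℕ) → Mat n
idM n i j with i Data.Fin.≟ j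
... | yes _ = 1ℚ
... | no _ = 0ℚ

_+M_ : {n : ℕ} → Mat n → Mat n → Mat n
(M +M N) i j = M i j + N i j

_·M_ : {n : ℕ} → ℚ → Mat n → Mat n
(r ·M M) i j = r * M i j

_*M_ : {n : ℕ} → Mat n → Mat n → Mat n
_*M_ {n} M N i j = sumFin n (λ k → M i k * N k j)

_*V_ : {n : ℕ} → Mat n → Vect n → Vect n
_*V_ {n} M v i = sumFin n (λ k → M i k * v k)

evalM : {n : ℕ} → Poly → Mat n → Mat n
evalM {n} [] A = λ _ _ → 0ℚ
evalM {n} (x ∷ p) A = (x ·M idM n) +M (A *M evalM p A)

ones : (n : ℕ) → Vect n
ones n _ = 1ℚ

module Setting (D : ℕ) where
  open Coeffs D public

  Amat : Mat (suc D)
  Amat i j with Data.Fin.toℕ i | Data.Fin.toℕ j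
  ... | i' | j' with i' ℕ.≟ j' | suc i' ℕ.≟ j' | i' ℕ.≟ suc j'
  ... | yes _ | _ | _ = a i'
  ... | no _ | yes _ | _ = b i'
  ... | no _ | no _ | yes _ = c i'
  ... | no _ | no _ | no _ = 0ℚ

  -- u₀ = 1, u₁ = λ/3, λ uᵢ = bᵢ uᵢ₊₁ + aᵢ uᵢ + cᵢ uᵢ₋₁ (i ≥ 1), solved for uᵢ₊₁
  u : ℕ → Poly
  u zero = 1ℚ ∷ []
  u (suc zero) = 0ℚ ∷ (1ℚ ÷ ℕ→ℚ 3) ∷ []
  u (suc (suc i)) =
    (1ℚ ÷ b (suc i)) ·ₚ
      ((Xₚ· u (suc i)) +ₚ (((0ℚ - a (suc i)) ·ₚ u (suc i)) +ₚ ((0ℚ - c (suc i)) ·ₚ u i)))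

  prodB : ℕ → ℚ
  prodB zero = 1ℚ
  prodB (suc i) = prodB i * b i

  prodC : ℕ → ℚ
  prodC zero = 1ℚ
  prodC (suc i) = prodC i * c (suc i)

  k : ℕ → ℚ
  k i = prodB i ÷ prodC i

  v : ℕ → Poly
  v i = k i ·ₚ u i

  B : ℕ → Mat (suc D)
  B i = evalM (v i) Amat

{-# OPTIONS --safe #-}
-- Since a_i + b_i + c_i = 3 and c_0 = b_D = 0, every row of A sums to 3, so the all-ones
-- vector is an eigenvector of A for 3 and hence of p(A) for p(3), for every polynomial p.
-- At λ = 3 the recurrence for u_i reads 3 u_i = b_i u_{i+1} + a_i u_i + c_i u_{i-1}, which
-- the constant sequence 1 satisfies; as b_i ≠ 0 for i < D it determines u_i(3) = 1, and so
-- B_i 𝟙 = k_i u_i(3) 𝟙 = k_i 𝟙.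
module Submission where

open import Defs
open import Data.Nat as ℕ using (ℕ; zero; suc; _≤_; _<_; s≤s)
import Data.Nat.Properties as ℕP
import Data.Integer as ℤ
import Data.Integer.Properties as ℤP
import Data.Integer.Solver as ℤSolver
open import Data.Fin as F using (Fin; toℕ)
import Data.Fin.Properties as FP
open import Data.Rational using (ℚ; 0ℚ; 1ℚ; _+_; _*_; _-_; 1/_; mkℚ; toℚᵘ; Positive; NonNegative; ≢-nonZero)
open import Data.Rational.Properties as QP using (_≟_)
import Data.Rational.Unnormalised as U
import Data.Rational.Unnormalised.Properties as UP
open import Data.Nat.Coprimality using (1-coprimeTo)
import Data.Nat.Coprimality as Coprime
open import Data.List using ([]; _∷_)
open import Data.Empty using (⊥-elim)
open import Data.Sum using (inj₁; inj₂)
open import Function using (_∘′_)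
open import Relation.Binary.PropositionalEquality
open import Relation.Nullary using (yes; no)
open import Data.Rational.Solver using (module +-*-Solver)
open +-*-Solver

ℕ→ℚ-mkℚ : ∀ n → ℕ→ℚ n ≡ mkℚ (ℤ.+ n) 0 (Coprime.sym (1-coprimeTo n))
ℕ→ℚ-mkℚ n = QP.normalize-coprime (Coprime.sym (1-coprimeTo n))

ℕ→ℚ-+ : ∀ m n → ℕ→ℚ (m ℕ.+ n) ≡ ℕ→ℚ m + ℕ→ℚ n
ℕ→ℚ-+ m n = QP.toℚᵘ-injective
  (UP.≃-trans toℚᵘ-sum (UP.≃-sym (QP.toℚᵘ-homo-+ (ℕ→ℚ m) (ℕ→ℚ n))))
  where
  open ℤSolver.+-*-Solver renaming (solve to solveℤ; _:+_ to _⊕_; _:*_ to _⊗_; _:=_ to _≐_; con to cst)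
  toℚᵘ-sum : toℚᵘ (ℕ→ℚ (m ℕ.+ n)) U.≃ (toℚᵘ (ℕ→ℚ m) U.+ toℚᵘ (ℕ→ℚ n))
  toℚᵘ-sum rewrite ℕ→ℚ-mkℚ (m ℕ.+ n) | ℕ→ℚ-mkℚ m | ℕ→ℚ-mkℚ n =
    U.*≡* (trans (cong (ℤ._* ℤ.+ 1) (ℤP.pos-+ m n))
      (solveℤ 2 (λ M N → (M ⊕ N) ⊗ cst (ℤ.+ 1) ≐ (M ⊗ cst (ℤ.+ 1) ⊕ N ⊗ cst (ℤ.+ 1)) ⊗ cst (ℤ.+ 1)) refl (ℤ.+ m) (ℤ.+ n)))

ℕ→ℚ-nonNeg : ∀ n → NonNegative (ℕ→ℚ n)
ℕ→ℚ-nonNeg n = QP.normalize-nonNeg n 1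

ℕ→ℚ-pos : ∀ n → Positive (ℕ→ℚ (suc n))
ℕ→ℚ-pos n = QP.normalize-pos (suc n) 1

pos⇒≢0 : ∀ p → .{{Positive p}} → p ≢ 0ℚ
pos⇒≢0 p p≡0 = QP.<⇒≢ (QP.positive⁻¹ p) (sym p≡0)

x÷y*y≡x : ∀ x y → y ≢ 0ℚ → (x ÷ y) * y ≡ x
x÷y*y≡x x y y≢0 with y ≟ 0ℚ
... | yes y≡0 = ⊥-elim (y≢0 y≡0)
... | no y≢0′ = begin
  x * 1/_ y {{≢-nonZero y≢0′}} * y   ≡⟨ QP.*-assoc x _ y ⟩
  x * (1/_ y {{≢-nonZero y≢0′}} * y) ≡⟨ cong (x *_) (QP.*-inverseˡ y {{≢-nonZero y≢0′}}) ⟩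
  x * 1ℚ                             ≡⟨ QP.*-identityʳ x ⟩
  x                                  ∎
  where open ≡-Reasoning

0÷y≡0 : ∀ y → 0ℚ ÷ y ≡ 0ℚ
0÷y≡0 y with y ≟ 0ℚ
... | yes _ = refl
... | no y≢0 = QP.*-zeroˡ (1/_ y {{≢-nonZero y≢0}})

÷-pos : ∀ x y → .{{Positive x}} → .{{Positive y}} → Positive (x ÷ y)
÷-pos x y with y ≟ 0ℚ
... | yes y≡0 = ⊥-elim (pos⇒≢0 y y≡0)
... | no y≢0 = QP.pos*pos⇒pos x (1/_ y {{≢-nonZero y≢0}}) {{QP.1/pos⇒pos y}}

x*y÷y≡x : ∀ x y → y ≢ 0ℚ → (x * y) ÷ y ≡ x
x*y÷y≡x x y y≢0 with y ≟ 0ℚ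
... | yes y≡0 = ⊥-elim (y≢0 y≡0)
... | no y≢0′ = begin
  x * y * 1/_ y {{≢-nonZero y≢0′}}   ≡⟨ QP.*-assoc x y _ ⟩
  x * (y * 1/_ y {{≢-nonZero y≢0′}}) ≡⟨ cong (x *_) (QP.*-inverseʳ y {{≢-nonZero y≢0′}}) ⟩
  x * 1ℚ                             ≡⟨ QP.*-identityʳ x ⟩
  x                                  ∎
  where open ≡-Reasoning

*-cancelʳ-≡ : ∀ x z y → y ≢ 0ℚ → x * y ≡ z * y → x ≡ z
*-cancelʳ-≡ x z y y≢0 xy≡zy = begin
  x             ≡⟨ sym (x*y÷y≡x x y y≢0) ⟩
  (x * y) ÷ y   ≡⟨ cong (_÷ y) xy≡zy ⟩
  (z * y) ÷ y   ≡⟨ x*y÷y≡x z y y≢0 ⟩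
  z             ∎
  where open ≡-Reasoning

sumFin-cong : ∀ n {f g : Fin n → ℚ} → (∀ j → f j ≡ g j) → sumFin n f ≡ sumFin n g
sumFin-cong zero f≗g = refl
sumFin-cong (suc n) f≗g = cong₂ _+_ (f≗g F.zero) (sumFin-cong n (λ j → f≗g (F.suc j)))

sumFin-0ℚ : ∀ n → sumFin n (λ _ → 0ℚ) ≡ 0ℚ
sumFin-0ℚ zero = refl
sumFin-0ℚ (suc n) = trans (QP.+-identityˡ _) (sumFin-0ℚ n)

sumFin-+ : ∀ n (f g : Fin n → ℚ) → sumFin n (λ j → f j + g j) ≡ sumFin n f + sumFin n g
sumFin-+ zero f g = refl
sumFin-+ (suc n) f g = trans (cong ((f F.zero + g F.zero) +_) (sumFin-+ n _ _))
  (solve 4 (λ a b c d → a :+ b :+ (c :+ d) := a :+ c :+ (b :+ d)) refl (f F.zero) (g F.zero) _ _)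

sumFin-*ˡ : ∀ n x (f : Fin n → ℚ) → sumFin n (λ j → x * f j) ≡ x * sumFin n f
sumFin-*ˡ zero x f = sym (QP.*-zeroʳ x)
sumFin-*ˡ (suc n) x f = trans (cong (x * f F.zero +_) (sumFin-*ˡ n x _)) (sym (QP.*-distribˡ-+ x _ _))

sumFin-swap : ∀ n m (f : Fin n → Fin m → ℚ) →
  sumFin n (λ j → sumFin m (f j)) ≡ sumFin m (λ k → sumFin n (λ j → f j k))
sumFin-swap zero m f = sym (sumFin-0ℚ m)
sumFin-swap (suc n) m f = trans (cong (sumFin m (f F.zero) +_) (sumFin-swap n m (λ j → f (F.suc j))))
  (sym (sumFin-+ m (f F.zero) (λ k → sumFin n (λ j → f (F.suc j) k))))

module _ {n : ℕ} where

  *V-cong : ∀ (M : Mat n) {w w′ : Vect n} → (∀ k → w k ≡ w′ k) → ∀ r → (M *V w) r ≡ (M *V w′) r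
  *V-cong M w≗w′ r = sumFin-cong n (λ k → cong (M r k *_) (w≗w′ k))

  *V-*ˡ : ∀ (M : Mat n) x (w : Vect n) r → (M *V (λ k → x * w k)) r ≡ x * (M *V w) r
  *V-*ˡ M x w r = trans (sumFin-cong n (λ k → solve 3 (λ m x w → m :* (x :* w) := x :* (m :* w)) refl (M r k) x (w k)))
    (sumFin-*ˡ n x (λ k → M r k * w k))

  +M-*V : ∀ (M N : Mat n) w r → ((M +M N) *V w) r ≡ (M *V w) r + (N *V w) r
  +M-*V M N w r = trans (sumFin-cong n (λ k → QP.*-distribʳ-+ (w k) (M r k) (N r k)))
    (sumFin-+ n (λ k → M r k * w k) (λ k → N r k * w k))

  ·M-*V : ∀ x (M : Mat n) w r → ((x ·M M) *V w) r ≡ x * (M *V w) r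
  ·M-*V x M w r = trans (sumFin-cong n (λ k → QP.*-assoc x (M r k) (w k)))
    (sumFin-*ˡ n x (λ k → M r k * w k))

  *M-*V : ∀ (M N : Mat n) w r → ((M *M N) *V w) r ≡ (M *V (N *V w)) r
  *M-*V M N w r = begin
    sumFin n (λ k → sumFin n (λ l → M r l * N l k) * w k)
      ≡⟨ sumFin-cong n (λ k → trans (QP.*-comm _ (w k)) (sym (sumFin-*ˡ n (w k) _))) ⟩
    sumFin n (λ k → sumFin n (λ l → w k * (M r l * N l k)))
      ≡⟨ sumFin-swap n n _ ⟩
    sumFin n (λ l → sumFin n (λ k → w k * (M r l * N l k)))
      ≡⟨ sumFin-cong n (λ l → trans (sumFin-cong n (λ k → solve 3 (λ w m n′ → w :* (m :* n′) := m :* (n′ :* w)) refl (w k) (M r l) (N l k)))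
                                      (sumFin-*ˡ n (M r l) _)) ⟩
    sumFin n (λ l → M r l * (N *V w) l) ∎
    where open ≡-Reasoning

idM-*V : ∀ n (w : Vect n) r → (idM n *V w) r ≡ w r
idM-*V (suc n) w F.zero = begin
  1ℚ * w F.zero + sumFin n (λ k → 0ℚ * w (F.suc k))
    ≡⟨ cong₂ _+_ (QP.*-identityˡ (w F.zero)) (trans (sumFin-cong n (λ k → QP.*-zeroˡ (w (F.suc k)))) (sumFin-0ℚ n)) ⟩
  w F.zero + 0ℚ
    ≡⟨ QP.+-identityʳ (w F.zero) ⟩
  w F.zero ∎
  where open ≡-Reasoning
idM-*V (suc n) w (F.suc r) = begin
  0ℚ * w F.zero + sumFin n (λ k → idM (suc n) (F.suc r) (F.suc k) * w (F.suc k))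
    ≡⟨ cong₂ _+_ (QP.*-zeroˡ (w F.zero)) (sumFin-cong n (λ k → cong (_* w (F.suc k)) (idM-suc r k))) ⟩
  0ℚ + (idM n *V (λ k → w (F.suc k))) r
    ≡⟨ trans (QP.+-identityˡ _) (idM-*V n (λ k → w (F.suc k)) r) ⟩
  w (F.suc r) ∎
  where
  open ≡-Reasoning
  idM-suc : ∀ r k → idM (suc n) (F.suc r) (F.suc k) ≡ idM n r k
  idM-suc r k with r F.≟ k
  ... | yes _ = refl
  ... | no _ = refl

evalP : Poly → ℚ → ℚ
evalP [] s = 0ℚ
evalP (x ∷ p) s = x + s * evalP p s

evalP-+ₚ : ∀ p q s → evalP (p +ₚ q) s ≡ evalP p s + evalP q s
evalP-+ₚ [] q s = sym (QP.+-identityˡ _)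
evalP-+ₚ (x ∷ p) [] s = sym (QP.+-identityʳ _)
evalP-+ₚ (x ∷ p) (y ∷ q) s = trans (cong (λ t → x + y + s * t) (evalP-+ₚ p q s))
  (solve 5 (λ x y s P Q → x :+ y :+ s :* (P :+ Q) := x :+ s :* P :+ (y :+ s :* Q)) refl x y s (evalP p s) (evalP q s))

evalP-·ₚ : ∀ r p s → evalP (r ·ₚ p) s ≡ r * evalP p s
evalP-·ₚ r [] s = sym (QP.*-zeroʳ r)
evalP-·ₚ r (x ∷ p) s = trans (cong (λ t → r * x + s * t) (evalP-·ₚ r p s))
  (solve 4 (λ r x s P → r :* x :+ s :* (r :* P) := r :* (x :+ s :* P)) refl r x s (evalP p s))

evalP-Xₚ· : ∀ p s → evalP (Xₚ· p) s ≡ s * evalP p s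
evalP-Xₚ· p s = QP.+-identityˡ (s * evalP p s)

evalM-eigen : ∀ {n} (M : Mat n) (w : Vect n) s → (∀ r → (M *V w) r ≡ s * w r) →
  ∀ p r → (evalM p M *V w) r ≡ evalP p s * w r
evalM-eigen {n} M w s Mw≡sw [] r =
  trans (sumFin-cong n (λ k → QP.*-zeroˡ (w k))) (trans (sumFin-0ℚ n) (sym (QP.*-zeroˡ (w r))))
evalM-eigen {n} M w s Mw≡sw (x ∷ p) r = begin
  (((x ·M idM n) +M (M *M E)) *V w) r
    ≡⟨ +M-*V (x ·M idM n) (M *M E) w r ⟩
  ((x ·M idM n) *V w) r + ((M *M E) *V w) r
    ≡⟨ cong₂ _+_ (trans (·M-*V x (idM n) w r) (cong (x *_) (idM-*V n w r))) (*M-*V M E w r) ⟩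
  x * w r + (M *V (E *V w)) r
    ≡⟨ cong (x * w r +_) (trans (*V-cong M (evalM-eigen M w s Mw≡sw p) r) (*V-*ˡ M e w r)) ⟩
  x * w r + e * (M *V w) r
    ≡⟨ cong (λ t → x * w r + e * t) (Mw≡sw r) ⟩
  x * w r + e * (s * w r)
    ≡⟨ solve 4 (λ x e s w → x :* w :+ e :* (s :* w) := (x :+ s :* e) :* w) refl x e s (w r) ⟩
  (x + s * e) * w r ∎
  where
  open ≡-Reasoning
  E = evalM p M
  e = evalP p s

δ : ℕ → ℕ → ℚ
δ zero zero = 1ℚ
δ zero (suc _) = 0ℚ
δ (suc _) zero = 0ℚ
δ (suc m) (suc n) = δ m n

δ-refl : ∀ m → δ m m ≡ 1ℚ
δ-refl zero = refl
δ-refl (suc m) = δ-refl m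

δ-≢ : ∀ {m n} → m ≢ n → δ m n ≡ 0ℚ
δ-≢ {zero} {zero} m≢n = ⊥-elim (m≢n refl)
δ-≢ {zero} {suc n} _ = refl
δ-≢ {suc m} {zero} _ = refl
δ-≢ {suc m} {suc n} m≢n = δ-≢ (m≢n ∘′ cong suc)

n≢2+n : ∀ n → n ≢ suc (suc n)
n≢2+n n = ℕP.<⇒≢ (ℕP.m<n⇒m<1+n (ℕP.n<1+n n))

sumFin-δ-< : ∀ n m → m < n → sumFin n (λ j → δ m (toℕ j)) ≡ 1ℚ
sumFin-δ-< (suc n) zero _ = trans (cong (1ℚ +_) (sumFin-0ℚ n)) (QP.+-identityʳ 1ℚ)
sumFin-δ-< (suc n) (suc m) (s≤s m<n) = trans (QP.+-identityˡ _) (sumFin-δ-< n m m<n)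

sumFin-δ-≥ : ∀ n m → n ≤ m → sumFin n (λ j → δ m (toℕ j)) ≡ 0ℚ
sumFin-δ-≥ zero m _ = refl
sumFin-δ-≥ (suc n) (suc m) (s≤s n≤m) = trans (QP.+-identityˡ _) (sumFin-δ-≥ n m n≤m)

tridiag : (α β γ : ℕ → ℚ) → ℕ → ℕ → ℚ
tridiag α β γ i j = α i * δ i j + β i * δ (suc i) j + γ i * δ i (suc j)

module _ (α β γ : ℕ → ℚ) where

  tridiag-diag : ∀ i → tridiag α β γ i i ≡ α i
  tridiag-diag i rewrite δ-refl i | δ-≢ (ℕP.1+n≢n {i}) | δ-≢ (ℕP.1+n≢n {i} ∘′ sym) =
    solve 3 (λ x y z → x :* con 1ℚ :+ y :* con 0ℚ :+ z :* con 0ℚ := x) refl (α i) (β i) (γ i)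

  tridiag-super : ∀ i → tridiag α β γ i (suc i) ≡ β i
  tridiag-super i rewrite δ-≢ (ℕP.1+n≢n {i} ∘′ sym) | δ-refl i | δ-≢ (n≢2+n i) =
    solve 3 (λ x y z → x :* con 0ℚ :+ y :* con 1ℚ :+ z :* con 0ℚ := y) refl (α i) (β i) (γ i)

  tridiag-sub : ∀ j → tridiag α β γ (suc j) j ≡ γ (suc j)
  tridiag-sub j rewrite δ-≢ (ℕP.1+n≢n {j}) | δ-≢ (n≢2+n j ∘′ sym) | δ-refl j =
    solve 3 (λ x y z → x :* con 0ℚ :+ y :* con 0ℚ :+ z :* con 1ℚ := z) refl (α (suc j)) (β (suc j)) (γ (suc j))

  tridiag-far : ∀ {i j} → i ≢ j → suc i ≢ j → i ≢ suc j → tridiag α β γ i j ≡ 0ℚ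
  tridiag-far {i} i≢j 1+i≢j i≢1+j rewrite δ-≢ i≢j | δ-≢ 1+i≢j | δ-≢ i≢1+j =
    solve 3 (λ x y z → x :* con 0ℚ :+ y :* con 0ℚ :+ z :* con 0ℚ := con 0ℚ) refl (α i) (β i) (γ i)

  tridiag-rowSum : ∀ D → β D ≡ 0ℚ → γ 0 ≡ 0ℚ → ∀ i → i ≤ D →
    sumFin (suc D) (λ j → tridiag α β γ i (toℕ j)) ≡ α i + β i + γ i
  tridiag-rowSum D βD≡0 γ0≡0 i i≤D = begin
    sumFin n (λ j → α i * Δ j + β i * Δ⁺ j + γ i * Δ⁻ j)
      ≡⟨ trans (sumFin-+ n (λ j → α i * Δ j + β i * Δ⁺ j) (λ j → γ i * Δ⁻ j))
               (cong (_+ sumFin n (λ j → γ i * Δ⁻ j)) (sumFin-+ n (λ j → α i * Δ j) (λ j → β i * Δ⁺ j))) ⟩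
    sumFin n (λ j → α i * Δ j) + sumFin n (λ j → β i * Δ⁺ j) + sumFin n (λ j → γ i * Δ⁻ j)
      ≡⟨ cong₂ _+_ (cong₂ _+_ (sumFin-*ˡ n (α i) Δ) (sumFin-*ˡ n (β i) Δ⁺)) (sumFin-*ˡ n (γ i) Δ⁻) ⟩
    α i * sumFin n Δ + β i * sumFin n Δ⁺ + γ i * sumFin n Δ⁻
      ≡⟨ cong₂ _+_ (cong₂ _+_ diagonal (superdiagonal i i≤D)) (subdiagonal i i≤D) ⟩
    α i + β i + γ i ∎
    where
    open ≡-Reasoning
    n = suc D
    Δ Δ⁺ Δ⁻ : Fin n → ℚ
    Δ j = δ i (toℕ j)
    Δ⁺ j = δ (suc i) (toℕ j)
    Δ⁻ j = δ i (suc (toℕ j))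
    diagonal : α i * sumFin n Δ ≡ α i
    diagonal = trans (cong (α i *_) (sumFin-δ-< n i (s≤s i≤D))) (QP.*-identityʳ (α i))
    superdiagonal : ∀ i → i ≤ D → β i * sumFin n (λ j → δ (suc i) (toℕ j)) ≡ β i
    superdiagonal i i≤D with ℕP.m≤n⇒m<n∨m≡n i≤D
    ... | inj₁ i<D = trans (cong (β i *_) (sumFin-δ-< n (suc i) (s≤s i<D))) (QP.*-identityʳ (β i))
    ... | inj₂ refl = trans (cong (β D *_) (sumFin-δ-≥ n n ℕP.≤-refl)) (trans (QP.*-zeroʳ (β D)) (sym βD≡0))
    subdiagonal : ∀ i → i ≤ D → γ i * sumFin n (λ j → δ i (suc (toℕ j))) ≡ γ i
    subdiagonal zero _ = trans (cong (γ 0 *_) (sumFin-0ℚ n)) (trans (QP.*-zeroʳ (γ 0)) (sym γ0≡0))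
    subdiagonal (suc m) 1+m≤D = trans (cong (γ (suc m) *_) (sumFin-δ-< n m (s≤s (ℕP.<⇒≤ 1+m≤D)))) (QP.*-identityʳ (γ (suc m)))

recurrence-preserves-1 : ∀ α β γ t U₀ U₁ → β ≢ 0ℚ → α + β + γ ≡ t →
  evalP U₀ t ≡ 1ℚ → evalP U₁ t ≡ 1ℚ →
  evalP ((1ℚ ÷ β) ·ₚ ((Xₚ· U₁) +ₚ (((0ℚ - α) ·ₚ U₁) +ₚ ((0ℚ - γ) ·ₚ U₀)))) t ≡ 1ℚ
recurrence-preserves-1 α β γ t U₀ U₁ β≢0 α+β+γ≡t U₀[t]≡1 U₁[t]≡1 = begin
  evalP ((1ℚ ÷ β) ·ₚ ((Xₚ· U₁) +ₚ (αU₁ +ₚ γU₀))) t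
    ≡⟨ evalP-·ₚ (1ℚ ÷ β) ((Xₚ· U₁) +ₚ (αU₁ +ₚ γU₀)) t ⟩
  (1ℚ ÷ β) * evalP ((Xₚ· U₁) +ₚ (αU₁ +ₚ γU₀)) t
    ≡⟨ cong ((1ℚ ÷ β) *_) (trans (evalP-+ₚ (Xₚ· U₁) (αU₁ +ₚ γU₀) t)
                                  (cong₂ _+_ (evalP-Xₚ· U₁ t) (evalP-+ₚ αU₁ γU₀ t))) ⟩
  (1ℚ ÷ β) * (t * evalP U₁ t + (evalP αU₁ t + evalP γU₀ t))
    ≡⟨ cong ((1ℚ ÷ β) *_) (cong₂ (λ x y → t * x + y) U₁[t]≡1
         (cong₂ _+_ (trans (evalP-·ₚ (0ℚ - α) U₁ t) (cong ((0ℚ - α) *_) U₁[t]≡1))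
                    (trans (evalP-·ₚ (0ℚ - γ) U₀ t) (cong ((0ℚ - γ) *_) U₀[t]≡1)))) ⟩
  (1ℚ ÷ β) * (t * 1ℚ + ((0ℚ - α) * 1ℚ + (0ℚ - γ) * 1ℚ))
    ≡⟨ cong (λ t → (1ℚ ÷ β) * (t * 1ℚ + ((0ℚ - α) * 1ℚ + (0ℚ - γ) * 1ℚ))) (sym α+β+γ≡t) ⟩
  (1ℚ ÷ β) * ((α + β + γ) * 1ℚ + ((0ℚ - α) * 1ℚ + (0ℚ - γ) * 1ℚ))
    ≡⟨ cong ((1ℚ ÷ β) *_) (solve 3 (λ α β γ →
         (α :+ β :+ γ) :* con 1ℚ :+ ((con 0ℚ :- α) :* con 1ℚ :+ (con 0ℚ :- γ) :* con 1ℚ) := β) refl α β γ) ⟩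
  (1ℚ ÷ β) * β
    ≡⟨ x÷y*y≡x 1ℚ β β≢0 ⟩
  1ℚ ∎
  where
  open ≡-Reasoning
  αU₁ γU₀ : Poly
  αU₁ = (0ℚ - α) ·ₚ U₁
  γU₀ = (0ℚ - γ) ·ₚ U₀

module _ (D′ : ℕ) where
  open Setting (suc D′)

  private
    D : ℕ
    D = suc D′

    instance
      Dq-pos : Positive Dq
      Dq-pos = ℕ→ℚ-pos D′

  den-pos : Positive den
  den-pos = QP.pos*pos⇒pos Dq (Dq + ℕ→ℚ 2) {{QP.pos+pos⇒pos Dq (ℕ→ℚ 2) {{ℕ→ℚ-pos 1}}}}

  odd-pos : ∀ i → Positive (ℕ→ℚ 2 * ℕ→ℚ i + 1ℚ)
  odd-pos i = QP.nonNeg+pos⇒pos (ℕ→ℚ 2 * ℕ→ℚ i) {{QP.nonNeg*nonNeg⇒nonNeg (ℕ→ℚ 2) {{ℕ→ℚ-nonNeg 2}} (ℕ→ℚ i) {{ℕ→ℚ-nonNeg i}}}} 1ℚ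

  den*odd≢0 : ∀ i → den * (ℕ→ℚ 2 * ℕ→ℚ i + 1ℚ) ≢ 0ℚ
  den*odd≢0 i = pos⇒≢0 _ {{QP.pos*pos⇒pos den {{den-pos}} _ {{odd-pos i}}}}

  b-pos : ∀ j → j < D → Positive (b j)
  b-pos j j<D = ÷-pos numerator (den * (ℕ→ℚ 2 * Jq + 1ℚ)) {{numerator-pos}} {{QP.pos*pos⇒pos den {{den-pos}} _ {{odd-pos j}}}}
    where
    Jq = ℕ→ℚ j
    m = D′ ℕ.∸ j
    Dq-Jq≡ : Dq - Jq ≡ ℕ→ℚ (suc m)
    Dq-Jq≡ = begin
      Dq - Jq                        ≡⟨ cong (λ n → ℕ→ℚ n - Jq) D≡j+1+m ⟩
      ℕ→ℚ (j ℕ.+ suc m) - Jq         ≡⟨ cong (_- Jq) (ℕ→ℚ-+ j (suc m)) ⟩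
      Jq + ℕ→ℚ (suc m) - Jq          ≡⟨ solve 2 (λ J M → J :+ M :- J := M) refl Jq (ℕ→ℚ (suc m)) ⟩
      ℕ→ℚ (suc m)                    ∎
      where
      open ≡-Reasoning
      D≡j+1+m : D ≡ j ℕ.+ suc m
      D≡j+1+m = sym (trans (ℕP.+-suc j m) (cong suc (ℕP.m+[n∸m]≡n (ℕP.m<1+n⇒m≤n j<D))))
    instance
      Jq-nonNeg : NonNegative Jq
      Jq-nonNeg = ℕ→ℚ-nonNeg j
      Dq-Jq-pos : Positive (Dq - Jq)
      Dq-Jq-pos = subst Positive (sym Dq-Jq≡) (ℕ→ℚ-pos m)
      three-pos : Positive (ℕ→ℚ 3)
      three-pos = ℕ→ℚ-pos 2
      two-pos : Positive (ℕ→ℚ 2)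
      two-pos = ℕ→ℚ-pos 1
    numerator : ℚ
    numerator = ℕ→ℚ 3 * (Dq - Jq) * (Jq + 1ℚ) * (Dq + Jq + ℕ→ℚ 2)
    numerator-pos : Positive numerator
    numerator-pos =
      QP.pos*pos⇒pos (ℕ→ℚ 3 * (Dq - Jq) * (Jq + 1ℚ))
        {{QP.pos*pos⇒pos (ℕ→ℚ 3 * (Dq - Jq)) {{QP.pos*pos⇒pos (ℕ→ℚ 3) (Dq - Jq)}} (Jq + 1ℚ) {{QP.nonNeg+pos⇒pos Jq 1ℚ}}}}
        (Dq + Jq + ℕ→ℚ 2) {{QP.pos+pos⇒pos (Dq + Jq) {{QP.pos+nonNeg⇒pos Dq Jq}} (ℕ→ℚ 2)}}

  c0≡0 : c 0 ≡ 0ℚ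
  c0≡0 = trans (cong (_÷ (den * (ℕ→ℚ 2 * ℕ→ℚ 0 + 1ℚ)))
                 (solve 1 (λ X → con (ℕ→ℚ 3) :* (X :- con 0ℚ :+ con 1ℚ) :* con 0ℚ :* (X :+ con 0ℚ :+ con 1ℚ) := con 0ℚ) refl Dq))
               (0÷y≡0 (den * (ℕ→ℚ 2 * ℕ→ℚ 0 + 1ℚ)))

  bD≡0 : b D ≡ 0ℚ
  bD≡0 = trans (cong (_÷ (den * (ℕ→ℚ 2 * Dq + 1ℚ)))
                 (solve 1 (λ X → con (ℕ→ℚ 3) :* (X :- X) :* (X :+ con 1ℚ) :* (X :+ X :+ con (ℕ→ℚ 2)) := con 0ℚ) refl Dq))
               (0÷y≡0 (den * (ℕ→ℚ 2 * Dq + 1ℚ)))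

  -- After clearing the denominator D(D+2)(2i+1) this is a polynomial identity in D and i.
  a+b+c≡3 : ∀ i → a i + b i + c i ≡ ℕ→ℚ 3
  a+b+c≡3 i = *-cancelʳ-≡ _ _ (den * e) (den*odd≢0 i) (begin
    (a i + b i + c i) * (den * e)
      ≡⟨ solve 5 (λ α β γ d e → (α :+ β :+ γ) :* (d :* e) := α :* d :* e :+ β :* (d :* e) :+ γ :* (d :* e)) refl (a i) (b i) (c i) den e ⟩
    a i * den * e + b i * (den * e) + c i * (den * e)
      ≡⟨ cong₂ _+_ (cong₂ _+_ (cong (_* e) (x÷y*y≡x _ den (pos⇒≢0 den {{den-pos}})))
                               (x÷y*y≡x _ (den * e) (den*odd≢0 i)))
                   (x÷y*y≡x _ (den * e) (den*odd≢0 i)) ⟩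
    ℕ→ℚ 3 * I * (I + 1ℚ) * e
      + ℕ→ℚ 3 * (Dq - I) * (I + 1ℚ) * (Dq + I + ℕ→ℚ 2)
      + ℕ→ℚ 3 * (Dq - I + 1ℚ) * I * (Dq + I + 1ℚ)
      ≡⟨ solve 2 (λ Dq I →
           con (ℕ→ℚ 3) :* I :* (I :+ con 1ℚ) :* (con (ℕ→ℚ 2) :* I :+ con 1ℚ)
           :+ con (ℕ→ℚ 3) :* (Dq :- I) :* (I :+ con 1ℚ) :* (Dq :+ I :+ con (ℕ→ℚ 2))
           :+ con (ℕ→ℚ 3) :* (Dq :- I :+ con 1ℚ) :* I :* (Dq :+ I :+ con 1ℚ)
           := con (ℕ→ℚ 3) :* ((Dq :* (Dq :+ con (ℕ→ℚ 2))) :* (con (ℕ→ℚ 2) :* I :+ con 1ℚ))) refl Dq I ⟩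
    ℕ→ℚ 3 * (den * e) ∎)
    where
    open ≡-Reasoning
    I = ℕ→ℚ i
    e = ℕ→ℚ 2 * I + 1ℚ

  Amat-tridiag : ∀ r j → Amat r j ≡ tridiag a b c (toℕ r) (toℕ j)
  Amat-tridiag r j with toℕ r | toℕ j
  ... | i | j′ with i ℕ.≟ j′ | suc i ℕ.≟ j′ | i ℕ.≟ suc j′
  ... | yes refl | _ | _ = sym (tridiag-diag a b c i)
  ... | no _ | yes refl | _ = sym (tridiag-super a b c i)
  ... | no _ | no _ | yes refl = sym (tridiag-sub a b c j′)
  ... | no i≢j | no 1+i≢j | no i≢1+j = sym (tridiag-far a b c i≢j 1+i≢j i≢1+j)

  Amat-*V-ones : ∀ r → (Amat *V ones (suc D)) r ≡ ℕ→ℚ 3 * ones (suc D) r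
  Amat-*V-ones r = begin
    sumFin (suc D) (λ j → Amat r j * 1ℚ)
      ≡⟨ sumFin-cong (suc D) (λ j → trans (QP.*-identityʳ (Amat r j)) (Amat-tridiag r j)) ⟩
    sumFin (suc D) (λ j → tridiag a b c (toℕ r) (toℕ j))
      ≡⟨ tridiag-rowSum a b c D bD≡0 c0≡0 (toℕ r) (ℕP.m<1+n⇒m≤n (FP.toℕ<n r)) ⟩
    a (toℕ r) + b (toℕ r) + c (toℕ r)
      ≡⟨ a+b+c≡3 (toℕ r) ⟩
    ℕ→ℚ 3
      ≡⟨ sym (QP.*-identityʳ (ℕ→ℚ 3)) ⟩
    ℕ→ℚ 3 * 1ℚ ∎
    where open ≡-Reasoning

  u[3]≡1 : ∀ i → i ≤ D → evalP (u i) (ℕ→ℚ 3) ≡ 1ℚ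
  u[3]≡1 zero _ = refl
  u[3]≡1 (suc zero) _ = refl
  u[3]≡1 (suc (suc i)) 2+i≤D =
    recurrence-preserves-1 (a (suc i)) (b (suc i)) (c (suc i)) (ℕ→ℚ 3) (u i) (u (suc i))
      (pos⇒≢0 (b (suc i)) {{b-pos (suc i) 2+i≤D}}) (a+b+c≡3 (suc i))
      (u[3]≡1 i (ℕP.≤-trans (ℕP.n≤1+n i) 1+i≤D)) (u[3]≡1 (suc i) 1+i≤D)
    where
    1+i≤D : suc i ≤ D
    1+i≤D = ℕP.<⇒≤ 2+i≤D

lemma4p4 : (D : ℕ) → 1 ≤ D → (i : ℕ) → i ≤ D → (r : Fin (suc D)) →
    (Setting.B D i *V ones (suc D)) r ≡ Setting.k D i * ones (suc D) r
lemma4p4 (suc D′) _ i i≤D r = begin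
  (B i *V ones (suc D)) r         ≡⟨ evalM-eigen Amat (ones (suc D)) (ℕ→ℚ 3) (Amat-*V-ones D′) (v i) r ⟩
  evalP (k i ·ₚ u i) (ℕ→ℚ 3) * 1ℚ ≡⟨ cong (_* 1ℚ) (evalP-·ₚ (k i) (u i) (ℕ→ℚ 3)) ⟩
  k i * evalP (u i) (ℕ→ℚ 3) * 1ℚ  ≡⟨ cong (λ x → k i * x * 1ℚ) (u[3]≡1 D′ i i≤D) ⟩
  k i * 1ℚ * 1ℚ                   ≡⟨ QP.*-identityʳ (k i * 1ℚ) ⟩
  k i * 1ℚ                        ∎
  where
  D = suc D′
  open Setting D
  open ≡-Reasoning
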